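{- For every integer $n\ge1$, $\mathrm{p}_{312,231}(n)=F_n$, where $F_n$ are the Fibonacci numbers with $F_1=F_2=1$.
   Context: A parity-alternating permutation (PAP) of $[n]$ is a permutation $\pi$ with $\pi(i)\equiv i\pmod 2$ for all $i$. A permutation contains a pattern $\sigma$ if some subsequence of its one-line notation is order-isomorphic to $\sigma$, and avoids it otherwise. $\mathrm{p}_{\sigma,\tau}(n)$ is the number of PAPs of $[n]$ avoiding both $\sigma$ and $\tau$. -}

module Defs where

open import Data.Nat using (ℕ; zero; suc; _+_; _%_)
import Data.Nat as ℕ
open import Data.Fin using (Fin; toℕ; _<_; _<?_; _≟_)
open import Data.Fin.Properties using (all?; any?)
open import Data.Vec using (Vec; lookup; _∷_; [])
open import Data.Product using (Σ; _×_; _,_; ∃)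
open import Relation.Nullary using (¬_; Dec)
open import Relation.Nullary.Decidable using (_×-dec_; _→-dec_; ¬?; True)
open import Relation.Binary.PropositionalEquality using (_≡_)

fib : ℕ → ℕ
fib zero = zero
fib (suc zero) = suc zero
fib (suc (suc n)) = fib n + fib (suc n)

-- A word of length n over [n] in one-line notation (entries 0-indexed: the
-- value v : Fin n stands for v+1 ∈ [n], position i stands for i+1).
Word : ℕ → Set
Word n = Vec (Fin n) n

-- w is a permutation of [n] (injective, hence bijective on a finite set)
IsPerm : ∀ {n} → Word n → Set
IsPerm w = ∀ i j → lookup w i ≡ lookup w j → i ≡ j

isPerm? : ∀ {n} (w : Word n) → Dec (IsPerm w)
isPerm? w = all? λ i → all? λ j → (lookup w i ≟ lookup w j) →-dec (i ≟ j)

IsParityAlt : ∀ {n} → Word n → Set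
IsParityAlt w = ∀ i → suc (toℕ (lookup w i)) % 2 ≡ suc (toℕ i) % 2

isParityAlt? : ∀ {n} (w : Word n) → Dec (IsParityAlt w)
isParityAlt? w = all? λ i → suc (toℕ (lookup w i)) % 2 ℕ.≟ suc (toℕ i) % 2

-- A pattern of length 3 in one-line notation (values 0-indexed: 312 = 2 0 1).
Pattern3 : Set
Pattern3 = Vec (Fin 3) 3

pos : ∀ {n} → Fin n → Fin n → Fin n → Fin 3 → Fin n
pos i j k Fin.zero = i
pos i j k (Fin.suc Fin.zero) = j
pos i j k (Fin.suc (Fin.suc Fin.zero)) = k

OrderIso3 : ∀ {n} → Word n → Pattern3 → Fin n → Fin n → Fin n → Set
OrderIso3 w σ i j k =
  ∀ a b → ((lookup w (pos i j k a) < lookup w (pos i j k b)) → (lookup σ a < lookup σ b))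
        × ((lookup σ a < lookup σ b) → (lookup w (pos i j k a) < lookup w (pos i j k b)))

orderIso3? : ∀ {n} (w : Word n) σ i j k → Dec (OrderIso3 w σ i j k)
orderIso3? w σ i j k = all? λ a → all? λ b →
  ((lookup w (pos i j k a) <? lookup w (pos i j k b)) →-dec (lookup σ a <? lookup σ b))
  ×-dec ((lookup σ a <? lookup σ b) →-dec (lookup w (pos i j k a) <? lookup w (pos i j k b)))

Contains : ∀ {n} → Word n → Pattern3 → Set
Contains w σ = ∃ λ i → ∃ λ j → ∃ λ k → (i < j) × (j < k) × OrderIso3 w σ i j k

contains? : ∀ {n} (w : Word n) σ → Dec (Contains w σ)
contains? w σ = any? λ i → any? λ j → any? λ k →
  (i <? j) ×-dec (j <? k) ×-dec orderIso3? w σ i j k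

Avoids : ∀ {n} → Word n → Pattern3 → Set
Avoids w σ = ¬ Contains w σ

avoids? : ∀ {n} (w : Word n) σ → Dec (Avoids w σ)
avoids? w σ = ¬? (contains? w σ)

-- The (decidable) conditions are wrapped in `True` so that membership
-- proofs are unique, making the subtype's cardinality the count.
PAPAvoiding : (n : ℕ) → Pattern3 → Pattern3 → Set
PAPAvoiding n σ τ =
  Σ (Word n) λ w → True (isPerm? w) × True (isParityAlt? w)
                 × True (avoids? w σ) × True (avoids? w τ)

p312 : Pattern3
p312 = Fin.suc (Fin.suc Fin.zero) ∷ Fin.zero ∷ Fin.suc Fin.zero ∷ []

p231 : Pattern3
p231 = Fin.suc Fin.zero ∷ Fin.suc (Fin.suc Fin.zero) ∷ Fin.zero ∷ []

{-# OPTIONS --safe #-}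
-- Avoiding 312 and 231 forces a layered shape: if the first entry is v, the next entries are
-- v - 1, …, 0, and the remaining entries form a smaller permutation of the same kind on the
-- values above v.  So the permutations are direct sums δ_{a₁} ⊕ ⋯ ⊕ δ_{a_r} of decreasing
-- blocks, and such a sum is parity-alternating exactly when every a_i is odd.  They therefore
-- correspond to compositions of n into odd parts, and a composition of n + 3 into odd parts
-- either starts with a part 1 or arises from one of n + 1 by enlarging its first part by 2:
-- the Fibonacci recursion.
module Submission where

open import Defs
open import Data.Nat
  using (ℕ; zero; suc; _+_; _∸_; _≤_; _<_; _≥_; z≤n; s≤s; z<s; s≤s⁻¹; _≤?_; _<?_; _%_; parity)
open import Data.Nat.Properties
open import Data.Nat.Induction using (<-rec)
open import Data.Parity.Base as ℙ using (Parity; 0ℙ; 1ℙ)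
import Data.Parity.Properties as ℙ
open import Data.Fin as Fin using (Fin; toℕ; fromℕ<; punchOut)
open import Data.Fin.Properties
  using (any?; toℕ-fromℕ<; toℕ-injective; toℕ<n; injective⇒≤; punchOut-injective; +↔⊎)
open import Data.Fin.Patterns using (0F; 1F; 2F)
open import Data.Vec using (Vec; []; _∷_; lookup; tabulate)
open import Data.Vec.Properties using (lookup∘tabulate; tabulate∘lookup; tabulate-cong)
open import Data.Product using (Σ; _×_; _,_; ∃; proj₁; proj₂)
open import Data.Bool.Properties using (T-irrelevant)
open import Data.Unit using (tt)
open import Data.Sum using (_⊎_; inj₁; inj₂)
open import Data.Sum.Function.Propositional using (_⊎-↔_)
open import Data.Empty using (⊥; ⊥-elim)
open import Relation.Nullary using (yes; no; contradiction)
open import Relation.Nullary.Decidable using (True; toWitness; fromWitness)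
open import Function.Bundles using (_⇔_; mk⇔; Equivalence; _↔_; mk↔ₛ′)
open import Function.Properties.Inverse using (↔-trans; ↔-sym)
open import Relation.Binary using (tri<; tri≈; tri>)
open import Relation.Binary.PropositionalEquality

private
  variable
    a i j k m n r L : ℕ
    f t : ℕ → ℕ

parity-+ˡ : ∀ L {x y} → parity x ≡ parity y → parity (L + x) ≡ parity (L + y)
parity-+ˡ L {x} {y} eq = begin
  parity (L + x)           ≡⟨ ℙ.+-homo-+ L x ⟩
  parity L ℙ.+ parity x    ≡⟨ cong (parity L ℙ.+_) eq ⟩
  parity L ℙ.+ parity y    ≡⟨ ℙ.+-homo-+ L y ⟨
  parity (L + y)           ∎
  where open ≡-Reasoning

parity-+ˡ-cancel : ∀ L {x y} → parity (L + x) ≡ parity (L + y) → parity x ≡ parity y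
parity-+ˡ-cancel L {x} {y} eq =
  ℙ.+-cancelˡ-≡ (parity L) _ _ (trans (sym (ℙ.+-homo-+ L x)) (trans eq (ℙ.+-homo-+ L y)))

parity-∸ : i ≤ a → parity a ≡ 0ℙ → parity (a ∸ i) ≡ parity i
parity-∸ {i} {a} i≤a even = ℙ.+-cancelʳ-≡ (parity i) _ _ (begin
  parity (a ∸ i) ℙ.+ parity i  ≡⟨ ℙ.+-homo-+ (a ∸ i) i ⟨
  parity (a ∸ i + i)           ≡⟨ cong parity (m∸n+n≡m i≤a) ⟩
  parity a                     ≡⟨ even ⟩
  0ℙ                           ≡⟨ ℙ.p+p≡0ℙ (parity i) ⟨
  parity i ℙ.+ parity i        ∎)
  where open ≡-Reasoning

-- f restricted to [0, n) is the 0-indexed form of a PAP of [n] avoiding 312 and 231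
-- (shifting both positions and values by one does not change parity agreement).
record IsAvoidingPAP (f : ℕ → ℕ) (n : ℕ) : Set where
  field
    injective         : ∀ {i j} → i < n → j < n → f i ≡ f j → i ≡ j
    bounded           : ∀ {i} → i < n → f i < n
    parity-preserving : ∀ {i} → i < n → parity (f i) ≡ parity i
    avoids312         : ∀ {i j k} → i < j → j < k → k < n → f j < f k → f k < f i → ⊥
    avoids231         : ∀ {i j k} → i < j → j < k → k < n → f k < f i → f i < f j → ⊥

  sandwich : ∀ {i j k} → i < j → j < k → k < n → f k < f i → f k < f j × f j < f i
  sandwich {i} {j} {k} i<j j<k k<n fk<fi = below , above
    where
    j<n = <-trans j<k k<n
    i<n = <-trans i<j j<n
    below : f k < f j
    below with <-cmp (f k) (f j)
    ... | tri< fk<fj _ _ = fk<fj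
    ... | tri≈ _ fk≡fj _ = contradiction (injective k<n j<n fk≡fj) (>⇒≢ j<k)
    ... | tri> _ _ fj<fk = ⊥-elim (avoids312 i<j j<k k<n fj<fk fk<fi)
    above : f j < f i
    above with <-cmp (f j) (f i)
    ... | tri< fj<fi _ _ = fj<fi
    ... | tri≈ _ fj≡fi _ = contradiction (injective j<n i<n fj≡fi) (>⇒≢ i<j)
    ... | tri> _ _ fi<fj = ⊥-elim (avoids231 i<j j<k k<n fk<fi fi<fj)

Onto : (ℕ → ℕ) → ℕ → Set
Onto f n = ∀ {y} → y < n → ∃ λ i → i < n × f i ≡ y

isAvoidingPAP-0 : IsAvoidingPAP f 0
isAvoidingPAP-0 = record
  { injective = λ () ; bounded = λ () ; parity-preserving = λ ()
  ; avoids312 = λ _ _ () ; avoids231 = λ _ _ () }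

layer : ℕ → (ℕ → ℕ) → ℕ → ℕ
layer a t i with i ≤? a
... | yes _ = a ∸ i
... | no  _ = suc a + t (i ∸ suc a)

data LayerPosition (a : ℕ) : ℕ → Set where
  inside : i ≤ a → LayerPosition a i
  beyond : ∀ j → LayerPosition a (suc a + j)

layerPosition : ∀ a i → LayerPosition a i
layerPosition zero    zero    = inside z≤n
layerPosition zero    (suc i) = beyond i
layerPosition (suc a) zero    = inside z≤n
layerPosition (suc a) (suc i) with layerPosition a i
... | inside i≤a = inside (s≤s i≤a)
... | beyond j   = beyond j

layer-inside : i ≤ a → layer a t i ≡ a ∸ i
layer-inside {i} {a} i≤a with i ≤? a
... | yes _   = refl
... | no i≰a  = contradiction i≤a i≰a

layer-beyond : ∀ a j → layer a t (suc a + j) ≡ suc a + t j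
layer-beyond {t} a j with suc a + j ≤? a
... | yes a<a = contradiction (≤-trans (s≤s (m≤m+n a j)) a<a) (n≮n a)
... | no _    = cong (λ x → suc a + t x) (m+n∸m≡n (suc a) j)

layer-isAvoidingPAP : parity a ≡ 0ℙ → IsAvoidingPAP t m → IsAvoidingPAP (layer a t) (suc a + m)
layer-isAvoidingPAP {a} {t} {m} even valid = record
  { injective = injective ; bounded = bounded ; parity-preserving = parity-preserving
  ; avoids312 = avoids312 ; avoids231 = avoids231 }
  where
  module T = IsAvoidingPAP valid
  l = layer a t

  beyond⁻ : suc a + i < suc a + j → i < j
  beyond⁻ = +-cancelˡ-< (suc a) _ _

  beyond-<⁻ : l (suc a + i) < l (suc a + j) → t i < t j
  beyond-<⁻ {i} {j} lt = beyond⁻ (subst₂ _<_ (layer-beyond a i) (layer-beyond a j) lt)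

  inside<beyond : i ≤ a → l i < l (suc a + j)
  inside<beyond {i} {j} i≤a = subst₂ _<_ (sym (layer-inside i≤a)) (sym (layer-beyond a j))
    (s≤s (≤-trans (m∸n≤m a i) (m≤m+n a (t j))))

  descending : i < j → j ≤ a → l j < l i
  descending i<j j≤a =
    subst₂ _<_ (sym (layer-inside j≤a)) (sym (layer-inside (≤-trans (<⇒≤ i<j) j≤a)))
    (∸-monoʳ-< i<j j≤a)

  beyond≮inside : suc a + i < j → j ≤ a → ⊥
  beyond≮inside {i} lt j≤a = n≮n a (≤-trans (≤-trans (s≤s (m≤m+n a i)) (<⇒≤ lt)) j≤a)

  injective : i < suc a + m → j < suc a + m → l i ≡ l j → i ≡ j
  injective {i} {j} i<n j<n eq with layerPosition a i | layerPosition a j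
  ... | inside i≤a | inside j≤a =
    ∸-cancelˡ-≡ i≤a j≤a (trans (sym (layer-inside i≤a)) (trans eq (layer-inside j≤a)))
  ... | inside i≤a | beyond _   = contradiction eq (<⇒≢ (inside<beyond i≤a))
  ... | beyond _   | inside j≤a = contradiction eq (>⇒≢ (inside<beyond j≤a))
  ... | beyond i′  | beyond j′  = cong (suc a +_) (T.injective (beyond⁻ i<n) (beyond⁻ j<n)
    (+-cancelˡ-≡ (suc a) _ _ (trans (sym (layer-beyond a i′)) (trans eq (layer-beyond a j′)))))

  bounded : i < suc a + m → l i < suc a + m
  bounded {i} i<n with layerPosition a i
  ... | inside i≤a = subst (_< suc a + m) (sym (layer-inside i≤a))
                           (s≤s (≤-trans (m∸n≤m a i) (m≤m+n a m)))
  ... | beyond i′  = subst (_< suc a + m) (sym (layer-beyond a i′))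
                           (+-monoʳ-< (suc a) (T.bounded (beyond⁻ i<n)))

  parity-preserving : i < suc a + m → parity (l i) ≡ parity i
  parity-preserving {i} i<n with layerPosition a i
  ... | inside i≤a = trans (cong parity (layer-inside i≤a)) (parity-∸ i≤a even)
  ... | beyond i′  = trans (cong parity (layer-beyond a i′))
                           (parity-+ˡ (suc a) (T.parity-preserving (beyond⁻ i<n)))

  avoids312 : i < j → j < k → k < suc a + m → l j < l k → l k < l i → ⊥
  avoids312 {i} {j} {k} i<j j<k k<n lj<lk lk<li with layerPosition a k
  ... | inside k≤a = <-asym lj<lk (descending j<k k≤a)
  ... | beyond _ with layerPosition a i
  ...   | inside i≤a = <-asym lk<li (inside<beyond i≤a)
  ...   | beyond _ with layerPosition a j
  ...     | inside j≤a = beyond≮inside i<j j≤a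
  ...     | beyond _   = T.avoids312 (beyond⁻ i<j) (beyond⁻ j<k) (beyond⁻ k<n)
                                     (beyond-<⁻ lj<lk) (beyond-<⁻ lk<li)

  avoids231 : i < j → j < k → k < suc a + m → l k < l i → l i < l j → ⊥
  avoids231 {i} {j} {k} i<j j<k k<n lk<li li<lj with layerPosition a k
  ... | inside k≤a = <-asym li<lj (descending i<j (≤-trans (<⇒≤ j<k) k≤a))
  ... | beyond _ with layerPosition a i
  ...   | inside i≤a = <-asym lk<li (inside<beyond i≤a)
  ...   | beyond _ with layerPosition a j
  ...     | inside j≤a = beyond≮inside i<j j≤a
  ...     | beyond _   = T.avoids231 (beyond⁻ i<j) (beyond⁻ j<k) (beyond⁻ k<n)
                                     (beyond-<⁻ lk<li) (beyond-<⁻ li<lj)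

module UpperPart {f L m} (valid : IsAvoidingPAP f (L + m)) (onto : Onto f (L + m))
                 (lower-below : ∀ {i} → i < L → f i < L)
                 (upper-above : ∀ {j} → j < m → L ≤ f (L + j)) where
  open IsAvoidingPAP valid

  rest : ℕ → ℕ
  rest j = f (L + j) ∸ L

  f≡L+rest : j < m → f (L + j) ≡ L + rest j
  f≡L+rest j<m = sym (m+[n∸m]≡n (upper-above j<m))

  private
    shift< : i < m → L + i < L + m
    shift< = +-monoʳ-< L

    lift< : i < m → j < m → rest i < rest j → f (L + i) < f (L + j)
    lift< i<m j<m lt = subst₂ _<_ (sym (f≡L+rest i<m)) (sym (f≡L+rest j<m)) (+-monoʳ-< L lt)

  rest-isAvoidingPAP : IsAvoidingPAP rest m
  rest-isAvoidingPAP = record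
    { injective = λ i<m j<m eq → +-cancelˡ-≡ L _ _ (injective (shift< i<m) (shift< j<m)
        (trans (f≡L+rest i<m) (trans (cong (L +_) eq) (sym (f≡L+rest j<m)))))
    ; bounded = λ i<m → +-cancelˡ-< L _ _ (subst (_< L + m) (f≡L+rest i<m) (bounded (shift< i<m)))
    ; parity-preserving = λ {i} i<m → parity-+ˡ-cancel L
        (trans (cong parity (sym (f≡L+rest i<m))) (parity-preserving (shift< i<m)))
    ; avoids312 = λ i<j j<k k<m rj<rk rk<ri →
        avoids312 (+-monoʳ-< L i<j) (+-monoʳ-< L j<k) (shift< k<m)
                  (lift< (<-trans j<k k<m) k<m rj<rk) (lift< k<m (<-trans i<j (<-trans j<k k<m)) rk<ri)
    ; avoids231 = λ i<j j<k k<m rk<ri ri<rj →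
        avoids231 (+-monoʳ-< L i<j) (+-monoʳ-< L j<k) (shift< k<m)
                  (lift< k<m (<-trans i<j (<-trans j<k k<m)) rk<ri)
                  (lift< (<-trans i<j (<-trans j<k k<m)) (<-trans j<k k<m) ri<rj)
    }

  rest-onto : Onto rest m
  rest-onto {y} y<m with onto (shift< y<m)
  ... | p , p<n , fp≡L+y with p <? L
  ...   | yes p<L = contradiction (subst (_< L) fp≡L+y (lower-below p<L)) (≤⇒≯ (m≤m+n L y))
  ...   | no p≮L with m≤n⇒∃[o]m+o≡n (≮⇒≥ p≮L)
  ...     | j , refl = j , +-cancelˡ-< L _ _ p<n , trans (cong (_∸ L) fp≡L+y) (m+n∸m≡n L y)

module FirstLayer {f n} (valid : IsAvoidingPAP f n) (onto : Onto f n) (0<n : 0 < n) where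
  open IsAvoidingPAP valid

  top : ℕ
  top = f 0

  top<n : top < n
  top<n = bounded 0<n

  private
    Descends : ℕ → Set
    Descends i = ∀ {r} → r ≤ i → f r ≡ top ∸ r

    descends-injective : i ≤ top → Descends i → j < n → r ≤ i → f j ≡ top ∸ r → j ≡ r
    descends-injective i≤top desc j<n r≤i eq =
      injective j<n (≤-<-trans (≤-trans r≤i i≤top) top<n) (trans eq (sym (desc r≤i)))

    -- The value top - (i + 1) must sit at position i + 1: anywhere later, the entry at
    -- i + 1 would be squeezed strictly between it and top, hence equal to an earlier entry.
    descends-suc : suc i ≤ top → Descends i → f (suc i) ≡ top ∸ suc i
    descends-suc {i} si≤top desc
      with onto (≤-<-trans (m∸n≤m top (suc i)) top<n)
    ... | p , p<n , fp≡top∸si with <-cmp p (suc i)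
    ...   | tri≈ _ refl _ = fp≡top∸si
    ...   | tri< p<si _ _ = contradiction
            (∸-cancelˡ-≡ (≤-trans (<⇒≤ p<si) si≤top) si≤top
              (trans (sym (desc (s≤s⁻¹ p<si))) fp≡top∸si))
            (<⇒≢ p<si)
    ...   | tri> _ _ si<p =
            contradiction (descends-injective i≤top desc si<n q≤i fsi≡top∸q) (>⇒≢ (s≤s q≤i))
      where
      i≤top = ≤-trans (n≤1+n i) si≤top
      si<n = <-trans si<p p<n
      y = f (suc i)
      q = top ∸ y
      squeezed : f p < y × y < top
      squeezed = sandwich z<s si<p p<n (subst (_< top) (sym fp≡top∸si) (∸-monoʳ-< z<s si≤top))
      q≤i : q ≤ i
      q≤i = s≤s⁻¹ (subst (q <_) (m∸[m∸n]≡n si≤top)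
              (∸-monoʳ-< (subst (_< y) fp≡top∸si (proj₁ squeezed)) (<⇒≤ (proj₂ squeezed))))
      fsi≡top∸q : f (suc i) ≡ top ∸ q
      fsi≡top∸q = sym (m∸[m∸n]≡n (<⇒≤ (proj₂ squeezed)))

    descends : i ≤ top → Descends i
    descends {zero}  _      z≤n = refl
    descends {suc i} si≤top r≤si with m≤n⇒m<n∨m≡n r≤si
    ... | inj₁ r<si = descends (≤-trans (n≤1+n i) si≤top) (s≤s⁻¹ r<si)
    ... | inj₂ refl = descends-suc si≤top (descends (≤-trans (n≤1+n i) si≤top))

  prefix : i ≤ top → f i ≡ top ∸ i
  prefix i≤top = descends i≤top ≤-refl

  prefix-below : i < suc top → f i < suc top
  prefix-below {i} i<stop = s≤s (subst (_≤ top) (sym (prefix (s≤s⁻¹ i<stop))) (m∸n≤m top i))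

  suffix-above : top < i → i < n → top < f i
  suffix-above {i} top<i i<n with f i ≤? top
  ... | no  fi≰top = ≰⇒> fi≰top
  ... | yes fi≤top = contradiction (subst (_≤ top) (sym i≡top∸fi) (m∸n≤m top (f i))) (<⇒≱ top<i)
    where
    i≡top∸fi : i ≡ top ∸ f i
    i≡top∸fi = descends-injective ≤-refl (descends ≤-refl) i<n (m∸n≤m top (f i))
                 (sym (m∸[m∸n]≡n fi≤top))

-- `1∷ c` prepends a part 1 to c and `grow c` enlarges the first part of c by 2.
data OddComposition : ℕ → Set where
  []   : OddComposition 0
  1∷_  : OddComposition n → OddComposition (suc n)
  grow : OddComposition (suc n) → OddComposition (3 + n)

-- The layered permutation of c, with the first part of c enlarged by a.
layoutFrom : OddComposition n → ℕ → ℕ → ℕ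
layoutFrom []       a = λ _ → 0
layoutFrom (1∷ c)   a = layer a (layoutFrom c 0)
layoutFrom (grow c) a = layoutFrom c (2 + a)

layout : OddComposition n → ℕ → ℕ
layout c = layoutFrom c 0

grow-size : ∀ a n → 2 + a + suc n ≡ a + (3 + n)
grow-size a n = sym (trans (+-suc a (2 + n)) (cong suc (+-suc a (suc n))))

mutual
  layoutFrom-isAvoidingPAP : (c : OddComposition (suc n)) → parity a ≡ 0ℙ →
                     IsAvoidingPAP (layoutFrom c a) (a + suc n)
  layoutFrom-isAvoidingPAP {n} {a} (1∷ c) even =
    subst (IsAvoidingPAP _) (sym (+-suc a n)) (layer-isAvoidingPAP even (layout-isAvoidingPAP c))
  layoutFrom-isAvoidingPAP {a = a} (grow {n} c) even =
    subst (IsAvoidingPAP _) (grow-size a n) (layoutFrom-isAvoidingPAP c even)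

  layout-isAvoidingPAP : (c : OddComposition n) → IsAvoidingPAP (layout c) n
  layout-isAvoidingPAP []       = isAvoidingPAP-0
  layout-isAvoidingPAP (1∷ c)   = layoutFrom-isAvoidingPAP (1∷ c) refl
  layout-isAvoidingPAP (grow c) = layoutFrom-isAvoidingPAP (grow c) refl

layoutFrom-head : (c : OddComposition (suc n)) → a ≤ layoutFrom c a 0
layoutFrom-head (1∷ c)           = ≤-refl
layoutFrom-head {a = a} (grow c) = ≤-trans (m≤n+m a 2) (layoutFrom-head c)

layoutFrom-head-1∷≢grow : (c : OddComposition n) (c′ : OddComposition (suc m)) →
                          layoutFrom (1∷ c) a 0 ≢ layoutFrom (grow c′) a 0
layoutFrom-head-1∷≢grow {a = a} c c′ eq =
  n≮n a (≤-trans (n≤1+n (suc a)) (subst (2 + a ≤_) (sym eq) (layoutFrom-head c′)))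

layoutFrom-injective : ∀ a (c c′ : OddComposition n) →
  (∀ {i} → i < a + n → layoutFrom c a i ≡ layoutFrom c′ a i) → c ≡ c′
layoutFrom-injective a []       []        _ = refl
layoutFrom-injective a (1∷ c)   (1∷ c′)   h = cong 1∷_ (layoutFrom-injective 0 c c′ λ {j} j<n →
  +-cancelˡ-≡ (suc a) _ _ (trans (sym (layer-beyond a j)) (trans (h (beyond< j<n)) (layer-beyond a j))))
  where
  beyond< : j < n → suc a + j < a + suc n
  beyond< {j} {n} j<n = subst (suc a + j <_) (sym (+-suc a n)) (+-monoʳ-< (suc a) j<n)
layoutFrom-injective a (grow {n} c) (grow c′) h = cong grow (layoutFrom-injective (2 + a) c c′ λ {i} i<n →
  h (subst (i <_) (grow-size a n) i<n))
layoutFrom-injective a (1∷ c)   (grow c′) h =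
  contradiction (h (subst (0 <_) (sym (+-suc a _)) z<s)) (layoutFrom-head-1∷≢grow c c′)
layoutFrom-injective a (grow c) (1∷ c′)   h =
  contradiction (sym (h (subst (0 <_) (sym (+-suc a _)) z<s))) (layoutFrom-head-1∷≢grow c′ c)

prependLayer : ∀ v → parity v ≡ 0ℙ → OddComposition m → OddComposition (suc v + m)
prependLayer zero          _    c = 1∷ c
prependLayer (suc zero)    ()   c
prependLayer (suc (suc v)) even c = grow (prependLayer v even c)

layoutFrom-prependLayer : ∀ v (even : parity v ≡ 0ℙ) (c : OddComposition m) a →
                          layoutFrom (prependLayer v even c) a ≡ layer (v + a) (layout c)
layoutFrom-prependLayer zero          _    c a = refl
layoutFrom-prependLayer (suc (suc v)) even c a =
  trans (layoutFrom-prependLayer v even c (2 + a))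
        (cong (λ b → layer b (layout c)) (trans (+-suc v (suc a)) (cong suc (+-suc v a))))

layout-prependLayer : ∀ v (even : parity v ≡ 0ℙ) (c : OddComposition m) →
                      layout (prependLayer v even c) ≡ layer v (layout c)
layout-prependLayer v even c =
  trans (layoutFrom-prependLayer v even c 0) (cong (λ b → layer b (layout c)) (+-identityʳ v))

IsLayout : OddComposition n → (ℕ → ℕ) → Set
IsLayout {n} c f = ∀ {i} → i < n → layout c i ≡ f i

LayoutComplete : ℕ → Set
LayoutComplete n = ∀ {f} → IsAvoidingPAP f n → Onto f n → ∃ λ (c : OddComposition n) → IsLayout c f

layout-complete : ∀ n → LayoutComplete n
layout-complete = <-rec LayoutComplete step
  where
  step : ∀ n → (∀ {m} → m < n → LayoutComplete m) → LayoutComplete n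
  step zero    _   _ _ = [] , λ ()
  step (suc n) rec {f} valid onto with m≤n⇒∃[o]m+o≡n (FirstLayer.top<n valid onto z<s)
  ... | m , refl = prependLayer top even c , correct
    where
    open FirstLayer valid onto z<s
    open UpperPart valid onto prefix-below
      (λ {j} j<m → suffix-above (s≤s (m≤m+n top j)) (+-monoʳ-< (suc top) j<m))
    even : parity top ≡ 0ℙ
    even = IsAvoidingPAP.parity-preserving valid z<s
    ih = rec (s≤s (m≤n+m m top)) rest-isAvoidingPAP rest-onto
    c = proj₁ ih
    correct : IsLayout (prependLayer top even c) f
    correct {i} i<n = trans (cong-app (layout-prependLayer top even c) i) (layer≗f (layerPosition top i) i<n)
      where
      layer≗f : ∀ {i} → LayerPosition top i → i < suc top + m → layer top (layout c) i ≡ f i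
      layer≗f (inside i≤top) _   = trans (layer-inside i≤top) (sym (prefix i≤top))
      layer≗f (beyond j)     i<n = begin
        layer top (layout c) (suc top + j) ≡⟨ layer-beyond top j ⟩
        suc top + layout c j                ≡⟨ cong (suc top +_) (proj₂ ih j<m) ⟩
        suc top + rest j                    ≡⟨ f≡L+rest j<m ⟨
        f (suc top + j)                     ∎
        where
        open ≡-Reasoning
        j<m = +-cancelˡ-< (suc top) _ _ i<n

suc%2≡⇔parity≡ : ∀ x y → (suc x % 2 ≡ suc y % 2) ⇔ (parity x ≡ parity y)
suc%2≡⇔parity≡ x y = mk⇔ (λ eq → flip-injective (trans (sym (suc%2 x)) (trans eq (suc%2 y))))
                         (λ eq → trans (suc%2 x) (trans (cong flip eq) (sym (suc%2 y))))
  where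
  flip : Parity → ℕ
  flip 0ℙ = 1
  flip 1ℙ = 0
  flip-injective : ∀ {p q} → flip p ≡ flip q → p ≡ q
  flip-injective {0ℙ} {0ℙ} _ = refl
  flip-injective {1ℙ} {1ℙ} _ = refl
  suc%2 : ∀ x → suc x % 2 ≡ flip (parity x)
  suc%2 zero          = refl
  suc%2 (suc zero)    = refl
  suc%2 (suc (suc x)) = suc%2 x

isPerm-surjective : (w : Word n) → IsPerm w → ∀ y → ∃ λ i → lookup w i ≡ y
isPerm-surjective {suc n} w perm y with any? (λ i → lookup w i Fin.≟ y)
... | yes hit = hit
... | no miss = contradiction (injective⇒≤ punchOut-injective′) (n≮n n)
  where
  y≢ : ∀ i → y ≢ lookup w i
  y≢ i eq = miss (i , sym eq)
  punchOut-injective′ : ∀ {i j} → punchOut (y≢ i) ≡ punchOut (y≢ j) → i ≡ j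
  punchOut-injective′ {i} {j} eq = perm i j (punchOut-injective (y≢ i) (y≢ j) eq)

entry : Vec (Fin m) n → ℕ → ℕ
entry []       _       = 0
entry (x ∷ _)  zero    = toℕ x
entry (_ ∷ xs) (suc i) = entry xs i

lookup≗entry : (w : Vec (Fin m) n) (i : Fin n) → toℕ (lookup w i) ≡ entry w (toℕ i)
lookup≗entry (_ ∷ _)  Fin.zero    = refl
lookup≗entry (_ ∷ xs) (Fin.suc i) = lookup≗entry xs i

realises : (σ : Pattern3) (w : Word n) {i j k : Fin n} → IsPerm σ →
           (∀ a b → lookup σ a Fin.< lookup σ b → lookup w (pos i j k a) Fin.< lookup w (pos i j k b)) →
           OrderIso3 w σ i j k
realises σ w {i} {j} {k} σ-injective monotone a b = reflect , monotone a b
  where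
  reflect : lookup w (pos i j k a) Fin.< lookup w (pos i j k b) → lookup σ a Fin.< lookup σ b
  reflect lt with <-cmp (toℕ (lookup σ a)) (toℕ (lookup σ b))
  ... | tri< σa<σb _ _ = σa<σb
  ... | tri≈ _ σa≡σb _ = contradiction
    (subst (λ c → lookup w (pos i j k c) Fin.< _) (σ-injective a b (toℕ-injective σa≡σb)) lt) (n≮n _)
  ... | tri> _ _ σb<σa = contradiction (monotone b a σb<σa) (<-asym lt)

AvoidingPAPProofs : Word n → Set
AvoidingPAPProofs w = True (isPerm? w) × True (isParityAlt? w) × True (avoids? w p312) × True (avoids? w p231)

AvoidingPAPProofs-irrelevant : {w : Word n} (p q : AvoidingPAPProofs w) → p ≡ q
AvoidingPAPProofs-irrelevant (a , b , c , d) (a′ , b′ , c′ , d′) =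
  cong₂ _,_ (T-irrelevant a a′)
    (cong₂ _,_ (T-irrelevant b b′) (cong₂ _,_ (T-irrelevant c c′) (T-irrelevant d d′)))

module WordAsFunction {n} (w : Word n) (f : ℕ → ℕ)
                      (w≗f : ∀ i → toℕ (lookup w i) ≡ f (toℕ i)) where

  private
    f≡lookup : (i<n : i < n) → f i ≡ toℕ (lookup w (fromℕ< i<n))
    f≡lookup {i} i<n = trans (cong f (sym (toℕ-fromℕ< i<n))) (sym (w≗f _))

    toFin< : (i<n : i < n) (j<n : j < n) → f i < f j → lookup w (fromℕ< i<n) Fin.< lookup w (fromℕ< j<n)
    toFin< i<n j<n = subst₂ _<_ (f≡lookup i<n) (f≡lookup j<n)

    fromFin< : ∀ {i j} → lookup w i Fin.< lookup w j → f (toℕ i) < f (toℕ j)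
    fromFin< {i} {j} = subst₂ _<_ (w≗f i) (w≗f j)

    position< : (i<n : i < n) (j<n : j < n) → i < j → fromℕ< i<n Fin.< fromℕ< j<n
    position< i<n j<n = subst₂ _<_ (sym (toℕ-fromℕ< i<n)) (sym (toℕ-fromℕ< j<n))

    triple : i < j → j < k → k < n → i < n × j < n
    triple i<j j<k k<n = <-trans i<j (<-trans j<k k<n) , <-trans j<k k<n

  toIsAvoidingPAP : AvoidingPAPProofs w → IsAvoidingPAP f n
  toIsAvoidingPAP (perm? , alt? , no312? , no231?) = record
    { injective = λ i<n j<n eq → trans (sym (toℕ-fromℕ< i<n)) (trans (cong toℕ
        (toWitness perm? _ _ (toℕ-injective (trans (sym (f≡lookup i<n)) (trans eq (f≡lookup j<n))))))
        (toℕ-fromℕ< j<n))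
    ; bounded = λ i<n → subst (_< n) (sym (f≡lookup i<n)) (toℕ<n _)
    ; parity-preserving = λ {i} i<n → subst₂ (λ x y → parity x ≡ parity y)
        (sym (f≡lookup i<n)) (toℕ-fromℕ< i<n)
        (Equivalence.to (suc%2≡⇔parity≡ (toℕ (lookup w (fromℕ< i<n))) (toℕ (fromℕ< i<n)))
                        (toWitness alt? (fromℕ< i<n)))
    ; avoids312 = λ i<j j<k k<n fj<fk fk<fi → let (i<n , j<n) = triple i<j j<k k<n in
        toWitness no312? (_ , _ , _ , position< i<n j<n i<j , position< j<n k<n j<k ,
          realises p312 w (toWitness {a? = isPerm? p312} tt) λ where
            0F 0F (s≤s (s≤s ()))
            0F 1F ()
            0F 2F (s≤s ())
            1F 0F _ → <-trans (toFin< j<n k<n fj<fk) (toFin< k<n i<n fk<fi)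
            1F 1F ()
            1F 2F _ → toFin< j<n k<n fj<fk
            2F 0F _ → toFin< k<n i<n fk<fi
            2F 1F ()
            2F 2F (s≤s ()))
    ; avoids231 = λ i<j j<k k<n fk<fi fi<fj → let (i<n , j<n) = triple i<j j<k k<n in
        toWitness no231? (_ , _ , _ , position< i<n j<n i<j , position< j<n k<n j<k ,
          realises p231 w (toWitness {a? = isPerm? p231} tt) λ where
            0F 0F (s≤s ())
            0F 1F _ → toFin< i<n j<n fi<fj
            0F 2F ()
            1F 0F (s≤s ())
            1F 1F (s≤s (s≤s ()))
            1F 2F ()
            2F 0F _ → toFin< k<n i<n fk<fi
            2F 1F _ → <-trans (toFin< k<n i<n fk<fi) (toFin< i<n j<n fi<fj)
            2F 2F ())
    }

  toOnto : IsPerm w → Onto f n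
  toOnto perm {y} y<n with isPerm-surjective w perm (fromℕ< y<n)
  ... | i , wi≡y = toℕ i , toℕ<n i , trans (sym (w≗f i)) (trans (cong toℕ wi≡y) (toℕ-fromℕ< y<n))

  fromIsAvoidingPAP : IsAvoidingPAP f n → AvoidingPAPProofs w
  fromIsAvoidingPAP valid = fromWitness perm , fromWitness alt , fromWitness no312 , fromWitness no231
    where
    open IsAvoidingPAP valid
    perm : IsPerm w
    perm i j eq = toℕ-injective (injective (toℕ<n i) (toℕ<n j)
      (trans (sym (w≗f i)) (trans (cong toℕ eq) (w≗f j))))
    alt : IsParityAlt w
    alt i = Equivalence.from (suc%2≡⇔parity≡ (toℕ (lookup w i)) (toℕ i))
      (trans (cong parity (w≗f i)) (parity-preserving (toℕ<n i)))
    no312 : Avoids w p312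
    no312 (i , j , k , i<j , j<k , iso) = avoids312 i<j j<k (toℕ<n k)
      (fromFin< (proj₂ (iso 1F 2F) (s≤s z≤n)))
      (fromFin< (proj₂ (iso 2F 0F) (s≤s (s≤s z≤n))))
    no231 : Avoids w p231
    no231 (i , j , k , i<j , j<k , iso) = avoids231 i<j j<k (toℕ<n k)
      (fromFin< (proj₂ (iso 2F 0F) (s≤s z≤n)))
      (fromFin< (proj₂ (iso 0F 1F) (s≤s (s≤s z≤n))))

word : OddComposition n → Word n
word c = tabulate λ i → fromℕ< (IsAvoidingPAP.bounded (layout-isAvoidingPAP c) (toℕ<n i))

word≗layout : (c : OddComposition n) (i : Fin n) → toℕ (lookup (word c) i) ≡ layout c (toℕ i)
word≗layout c i = trans (cong toℕ (lookup∘tabulate _ i)) (toℕ-fromℕ< _)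

entry-word : (c : OddComposition n) → i < n → entry (word c) i ≡ layout c i
entry-word {i = i} c i<n = begin
  entry (word c) i                          ≡⟨ cong (entry (word c)) (toℕ-fromℕ< i<n) ⟨
  entry (word c) (toℕ (fromℕ< i<n))         ≡⟨ lookup≗entry (word c) (fromℕ< i<n) ⟨
  toℕ (lookup (word c) (fromℕ< i<n))        ≡⟨ word≗layout c (fromℕ< i<n) ⟩
  layout c (toℕ (fromℕ< i<n))               ≡⟨ cong (layout c) (toℕ-fromℕ< i<n) ⟩
  layout c i                                ∎
  where open ≡-Reasoning

classify : (w : Word n) → AvoidingPAPProofs w → ∃ λ (c : OddComposition n) → IsLayout c (entry w)
classify w proofs = layout-complete _ (toIsAvoidingPAP proofs) (toOnto (toWitness (proj₁ proofs)))
  where open WordAsFunction w (entry w) (lookup≗entry w)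

Σ-≡-irrelevant : {A : Set} {P : A → Set} → (∀ {a} (p q : P a) → p ≡ q) →
                 {x y : Σ A P} → proj₁ x ≡ proj₁ y → x ≡ y
Σ-≡-irrelevant irr {x = a , p} {y = .a , q} refl = cong (a ,_) (irr p q)

PAPAvoiding↔OddComposition : ∀ n → PAPAvoiding n p312 p231 ↔ OddComposition n
PAPAvoiding↔OddComposition n = mk↔ₛ′ to from to∘from from∘to
  where
  to : PAPAvoiding n p312 p231 → OddComposition n
  to (w , proofs) = proj₁ (classify w proofs)

  from : OddComposition n → PAPAvoiding n p312 p231
  from c = word c ,
    WordAsFunction.fromIsAvoidingPAP (word c) (layout c) (word≗layout c) (layout-isAvoidingPAP c)

  to∘from : ∀ c → to (from c) ≡ c
  to∘from c = layoutFrom-injective 0 _ c λ i<n →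
    trans (proj₂ (classify (word c) (proj₂ (from c))) i<n) (entry-word c i<n)

  from∘to : ∀ x → from (to x) ≡ x
  from∘to (w , proofs) = Σ-≡-irrelevant (λ {v} → AvoidingPAPProofs-irrelevant {w = v}) word≡w
    where
    c = proj₁ (classify w proofs)
    word≡w : word c ≡ w
    word≡w = begin
      word c                      ≡⟨ tabulate∘lookup (word c) ⟨
      tabulate (lookup (word c))  ≡⟨ tabulate-cong (λ i → toℕ-injective (begin
        toℕ (lookup (word c) i)     ≡⟨ word≗layout c i ⟩
        layout c (toℕ i)            ≡⟨ proj₂ (classify w proofs) (toℕ<n i) ⟩
        entry w (toℕ i)             ≡⟨ lookup≗entry w i ⟨
        toℕ (lookup w i)            ∎)) ⟩
      tabulate (lookup w)         ≡⟨ tabulate∘lookup w ⟩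
      w                           ∎
      where open ≡-Reasoning

oddComposition-split : OddComposition (3 + n) ↔ (OddComposition (1 + n) ⊎ OddComposition (2 + n))
oddComposition-split =
  mk↔ₛ′ to from (λ { (inj₁ _) → refl ; (inj₂ _) → refl }) (λ { (1∷ _) → refl ; (grow _) → refl })
  where
  to : OddComposition (3 + n) → OddComposition (1 + n) ⊎ OddComposition (2 + n)
  to (1∷ c)   = inj₂ c
  to (grow c) = inj₁ c
  from : OddComposition (1 + n) ⊎ OddComposition (2 + n) → OddComposition (3 + n)
  from (inj₁ c) = grow c
  from (inj₂ c) = 1∷ c

oddComposition↔fib : ∀ n → OddComposition (suc n) ↔ Fin (fib (suc n))
oddComposition↔fib zero =
  mk↔ₛ′ (λ _ → 0F) (λ _ → 1∷ []) (λ { 0F → refl ; (Fin.suc ()) }) (λ { (1∷ []) → refl })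
oddComposition↔fib (suc zero) =
  mk↔ₛ′ (λ _ → 0F) (λ _ → 1∷ 1∷ []) (λ { 0F → refl ; (Fin.suc ()) }) (λ { (1∷ 1∷ []) → refl })
oddComposition↔fib (suc (suc n)) =
  ↔-trans oddComposition-split
    (↔-trans (oddComposition↔fib n ⊎-↔ oddComposition↔fib (suc n)) (↔-sym +↔⊎))

mainTheorem13 : (n : ℕ) → n ≥ 1 → PAPAvoiding n p312 p231 ↔ Fin (fib n)
mainTheorem13 (suc n) _ = ↔-trans (PAPAvoiding↔OddComposition (suc n)) (oddComposition↔fib n)
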